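{- Let $G$ be a graph with chromatic number $k=\chi(G)$, and let $H$ be its $(k+1)$--hairy graph. Then every $\Omega_{uc}$--domination coloring of $H$ uses at least $k+1$ colors.
   Context: Graphs are finite, simple and undirected. The $l$--hairy graph of $G$ is obtained by attaching $l$ new leaf vertices (pendant vertices) to each vertex of $G$. A coloring of a graph $H=(V,E)$ is a map $c:V\to\{0,1,2,\dots\}$ with $c(u)\neq c(v)$ whenever $u,v$ are adjacent. Given $(H,c)$, a set $D\subseteq V$ is an up--color dominating $c$--set if (1) every vertex $v\notin D$ has a neighbor $d\in D$ with $c(v)<c(d)$, and (2) $D$ contains no vertex of color $0$. The weight of $D$ is $\sum_{v\in D}c(v)$; $\omega_{uc}(H,c)$ is the minimum weight of an up--color dominating $c$--set; $\Omega_{uc}(H)$ is the minimum of $\omega_{uc}(H,c)$ over all colorings $c$. An $\Omega_{uc}$--domination coloring of $H$ is a coloring $c$ with $\omega_{uc}(H,c)=\Omega_{uc}(H)$. -}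

module Defs where

open import Data.Nat using (ℕ; zero; suc; _+_; _*_; _≤_; _<_)
open import Data.Nat.Properties using () renaming (_≟_ to _≟ℕ_)
open import Data.Fin using (Fin; splitAt; quotRem; _≟_)
open import Data.List using (List; map; length; deduplicate; allFin)
open import Data.Nat.ListAction using (sum)
open import Data.Bool using (Bool; true; false; if_then_else_)
open import Data.Sum using (inj₁; inj₂)
open import Data.Product using (Σ; _×_; _,_; proj₂; ∃)
open import Relation.Nullary using (¬_; does)
open import Relation.Binary.PropositionalEquality using (_≡_; _≢_; refl)

record Graph (n : ℕ) : Set where
  field
    adj   : Fin n → Fin n → Bool
    sym   : ∀ u v → adj u v ≡ adj v u
    irrefl : ∀ v → adj v v ≡ false
open Graph public

Adjacent : ∀ {n} → Graph n → Fin n → Fin n → Set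
Adjacent G u v = adj G u v ≡ true

-- The l-hairy graph of G (on n vertices) has n + n * l vertices:
-- vertices 0..n-1 are the original vertices (via splitAt), and a vertex
-- j : Fin (n * l) of the second block is a leaf attached to the original
-- vertex  proj₂ (quotRem l j)  (the quotient j / l).

owner : ∀ {n} l → Fin (n * l) → Fin n
owner l j = proj₂ (quotRem l j)

hairyAdj : ∀ {n} → Graph n → (l : ℕ) → Fin (n + n * l) → Fin (n + n * l) → Bool
hairyAdj {n} G l u v with splitAt n u | splitAt n v
... | inj₁ a | inj₁ b = adj G a b
... | inj₁ a | inj₂ j = does (a ≟ owner l j)
... | inj₂ j | inj₁ a = does (a ≟ owner l j)
... | inj₂ _ | inj₂ _ = false

hairyAdj-sym : ∀ {n} (G : Graph n) l u v → hairyAdj G l u v ≡ hairyAdj G l v u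
hairyAdj-sym {n} G l u v with splitAt n u | splitAt n v
... | inj₁ a | inj₁ b = sym G a b
... | inj₁ a | inj₂ j = refl
... | inj₂ j | inj₁ a = refl
... | inj₂ _ | inj₂ _ = refl

hairyAdj-irrefl : ∀ {n} (G : Graph n) l v → hairyAdj G l v v ≡ false
hairyAdj-irrefl {n} G l v with splitAt n v
... | inj₁ a = irrefl G a
... | inj₂ _ = refl

hairy : ∀ {n} → Graph n → (l : ℕ) → Graph (n + n * l)
hairy G l = record { adj = hairyAdj G l ; sym = hairyAdj-sym G l ; irrefl = hairyAdj-irrefl G l }

ProperColoringWith : ∀ {n} → Graph n → (m : ℕ) → (Fin n → Fin m) → Set
ProperColoringWith G m f = ∀ u v → Adjacent G u v → f u ≢ f v

IsChromaticNumber : ∀ {n} → Graph n → ℕ → Set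
IsChromaticNumber {n} G k =
  (Σ (Fin n → Fin k) (ProperColoringWith G k)) ×
  (∀ m (f : Fin n → Fin m) → ProperColoringWith G m f → k ≤ m)

IsColoring : ∀ {n} → Graph n → (Fin n → ℕ) → Set
IsColoring G c = ∀ u v → Adjacent G u v → c u ≢ c v

numColors : ∀ {n} → (Fin n → ℕ) → ℕ
numColors {n} c = length (deduplicate _≟ℕ_ (map c (allFin n)))

IsUpColorDominating : ∀ {n} → Graph n → (Fin n → ℕ) → (Fin n → Bool) → Set
IsUpColorDominating G c D =
  (∀ v → D v ≡ false → Σ _ λ d → D d ≡ true × Adjacent G v d × c v < c d) ×
  (∀ v → D v ≡ true → c v ≢ 0)

weight : ∀ {n} → (Fin n → ℕ) → (Fin n → Bool) → ℕ
weight {n} c D = sum (map (λ v → if D v then c v else 0) (allFin n))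

IsOmegaUC : ∀ {n} → Graph n → (Fin n → ℕ) → ℕ → Set
IsOmegaUC G c w =
  (Σ _ λ D → IsUpColorDominating G c D × weight c D ≡ w) ×
  (∀ D → IsUpColorDominating G c D → w ≤ weight c D)

IsBigOmegaUC : ∀ {n} → Graph n → ℕ → Set
IsBigOmegaUC G w =
  (Σ _ λ c → IsColoring G c × IsOmegaUC G c w) ×
  (∀ c w' → IsColoring G c → IsOmegaUC G c w' → w ≤ w')

IsOmegaDominationColoring : ∀ {n} → Graph n → (Fin n → ℕ) → Set
IsOmegaDominationColoring G c =
  IsColoring G c × Σ ℕ λ w → IsOmegaUC G c w × IsBigOmegaUC G w

{-# OPTIONS --safe #-}

-- Let D be an up-colour dominating set of minimum weight for an Ω_uc-domination colouring c
-- of H, and suppose c uses at most k colours. Colouring the hairs 0 turns any positive proper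
-- colouring g of G into a colouring of H whose ω_uc is Σ g, so the weight of D, a sum over the
-- stars (a vertex with its hairs), is at most Σ g. Renumbering the colours of c on G in
-- increasing order gives such a g below every star weight (a star whose centre is outside D
-- carries k + 1 dominators), so equality holds star by star. This puts every centre in D and
-- its hairs outside D, so each hair has a smaller colour than its centre. But χ(G) = k forces
-- every colour of c to appear on G, and colours on G cannot descend forever.

module Submission where

open import Defs hiding (sym)
open import Data.Nat using (ℕ; zero; suc; _+_; _*_; _≤_; _<_; z≤n; s≤s; s≤s⁻¹; _<?_; _≤?_)
open import Data.Nat.Properties renaming (_≟_ to _≟ℕ_)
open import Data.Nat.Induction using (<-wellFounded)
open import Data.Nat.ListAction using () renaming (sum to sumˡ)
open import Data.Fin using (Fin; zero; suc; _↑ˡ_; _↑ʳ_; combine; remQuot; splitAt; fromℕ<; _≟_)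
import Data.Fin.Properties as Fin
open import Data.Bool using (Bool; true; false; if_then_else_)
import Data.Bool.Properties as Bool
open import Data.List using (List; _∷_; map; length; lookup; filter; upTo; allFin; tabulate; deduplicate)
open import Data.List.Properties using (map-tabulate; length-filter; filter-notAll; length-map; length-upTo)
open import Data.List.Membership.Propositional using (_∈_)
open import Data.List.Membership.Propositional.Properties
  using (∈-lookup; ∈-length; ∈-filter⁺; ∈-filter⁻; ∈-map⁺; ∈-upTo⁺; ∈-allFin; ∈-deduplicate⁺)
open import Data.List.Membership.Setoid.Properties using (index-injective)
open import Data.List.Relation.Binary.Subset.Propositional using (_⊆_)
open import Data.List.Relation.Unary.All as All using (All)
open import Data.List.Relation.Unary.Any as Any using (index; here; there)
open import Data.List.Relation.Unary.AllPairs using (_∷_)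
open import Data.List.Relation.Unary.Unique.Propositional using (Unique)
import Data.List.Relation.Unary.Unique.Propositional.Properties as Unique
open import Data.List.Relation.Unary.Unique.DecPropositional.Properties _≟ℕ_ using (deduplicate-!)
open import Data.Sum using (inj₁; inj₂; [_,_]′)
open import Data.Product using (∃; _×_; _,_; proj₁; proj₂; uncurry)
open import Algebra.Properties.CommutativeMonoid.Sum +-0-commutativeMonoid
  using (sum; sum-syntax; ∑-distrib-+; sum-cong-≗; sum-replicate-zero)
open import Induction.InfiniteDescent using (descent∧wf⇒empty)
open import Function using (_∘_; id; const)
open import Relation.Nullary using (¬_; Dec; yes; no; does; contradiction)
open import Relation.Nullary.Decidable using (_×-dec_; ¬?; dec-true)
open import Relation.Binary.Definitions using (tri<; tri≈; tri>)
open import Relation.Binary.PropositionalEquality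

sumˡ-allFin : ∀ n (f : Fin n → ℕ) → sumˡ (map f (allFin n)) ≡ sum f
sumˡ-allFin n f = trans (cong sumˡ (map-tabulate id f)) (sumˡ-tabulate n f)
  where
  sumˡ-tabulate : ∀ n (f : Fin n → ℕ) → sumˡ (tabulate f) ≡ sum f
  sumˡ-tabulate zero    f = refl
  sumˡ-tabulate (suc n) f = cong (f zero +_) (sumˡ-tabulate n (f ∘ suc))

sum-↑ : ∀ m {n} (f : Fin (m + n) → ℕ) → sum f ≡ ∑[ i < m ] f (i ↑ˡ n) + ∑[ j < n ] f (m ↑ʳ j)
sum-↑ zero    f = refl
sum-↑ (suc m) f = trans (cong (f zero +_) (sum-↑ m (f ∘ suc))) (sym (+-assoc (f zero) _ _))

sum-combine : ∀ m {n} (f : Fin (m * n) → ℕ) → sum f ≡ ∑[ i < m ] ∑[ j < n ] f (combine i j)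
sum-combine zero    f = refl
sum-combine (suc m) {n} f =
  trans (sum-↑ n f) (cong (sum (λ j → f (j ↑ˡ (m * n))) +_) (sum-combine m (f ∘ (n ↑ʳ_))))

sum-mono-≤ : ∀ {n} {f g : Fin n → ℕ} → (∀ i → f i ≤ g i) → sum f ≤ sum g
sum-mono-≤ {zero}  f≤g = z≤n
sum-mono-≤ {suc n} f≤g = +-mono-≤ (f≤g zero) (sum-mono-≤ (f≤g ∘ suc))

sum-mono-< : ∀ {n} {f g : Fin n → ℕ} → (∀ i → f i ≤ g i) → ∀ i → f i < g i → sum f < sum g
sum-mono-< f≤g zero    fi<gi = +-mono-<-≤ fi<gi (sum-mono-≤ (f≤g ∘ suc))
sum-mono-< f≤g (suc i) fi<gi = +-mono-≤-< (f≤g zero) (sum-mono-< (f≤g ∘ suc) i fi<gi)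

sum-squeeze : ∀ {n} {f g : Fin n → ℕ} → (∀ i → f i ≤ g i) → sum g ≤ sum f → ∀ i → f i ≡ g i
sum-squeeze f≤g ∑g≤∑f i = ≤-antisym (f≤g i) (≮⇒≥ λ fi<gi → <⇒≱ (sum-mono-< f≤g i fi<gi) ∑g≤∑f)

≤sum : ∀ {n} (f : Fin n → ℕ) i → f i ≤ sum f
≤sum f zero    = m≤m+n _ _
≤sum f (suc i) = ≤-trans (≤sum (f ∘ suc) i) (m≤n+m _ _)

n≤sum : ∀ {n} {f : Fin n → ℕ} → (∀ i → 0 < f i) → n ≤ sum f
n≤sum {zero}  f>0 = z≤n
n≤sum {suc n} f>0 = +-mono-≤ (f>0 zero) (n≤sum (f>0 ∘ suc))

module _ {A : Set} where

  lookup-injective : ∀ {xs : List A} → Unique xs → ∀ i j → lookup xs i ≡ lookup xs j → i ≡ j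
  lookup-injective (x∉xs ∷ u) zero    zero    _  = refl
  lookup-injective (x∉xs ∷ u) zero    (suc j) eq = contradiction eq (All.lookup x∉xs (∈-lookup j))
  lookup-injective (x∉xs ∷ u) (suc i) zero    eq = contradiction (sym eq) (All.lookup x∉xs (∈-lookup i))
  lookup-injective (x∉xs ∷ u) (suc i) (suc j) eq = cong suc (lookup-injective u i j eq)

  Unique∧⊆⇒length≤ : ∀ {xs ys : List A} → Unique xs → xs ⊆ ys → length xs ≤ length ys
  Unique∧⊆⇒length≤ {xs} u xs⊆ys = Fin.injective⇒≤ λ {i} {j} eq →
    lookup-injective u i j (index-injective (setoid A) (position i) (position j) eq)
    where
    position : ∀ i → lookup xs i ∈ _
    position i = xs⊆ys (∈-lookup i)

  descent-impossible : (f : A → ℕ) → (∀ a → ∃ λ b → f b < f a) → ¬ A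
  descent-impossible f descent a = descent∧wf⇒empty step <-wellFounded (f a) (a , refl)
    where
    step : ∀ {x} → (∃ λ a → f a ≡ x) → ∃ λ y → y < x × ∃ λ b → f b ≡ y
    step (a , refl) = let b , fb<fa = descent a in f b , fb<fa , b , refl

χ≤length : ∀ {n} (G : Graph n) {k} → IsChromaticNumber G k → (f : Fin n → ℕ) → IsColoring G f →
           ∀ {xs} → (∀ v → f v ∈ xs) → k ≤ length xs
χ≤length G (_ , minimal) f proper {xs} f∈xs = minimal (length xs) (λ v → index (f∈xs v))
  λ u v uv eq → proper u v uv (index-injective (setoid ℕ) (f∈xs u) (f∈xs v) eq)

inRange? : ∀ b y → Dec (0 < y × y ≤ b)
inRange? b y = 0 <? y ×-dec y ≤? b

positivesUpTo : ℕ → List ℕ → List ℕ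
positivesUpTo b = filter (inRange? b)

relabel : List ℕ → ℕ → ℕ
relabel xs zero    = length xs
relabel xs (suc x) = length (positivesUpTo (suc x) xs)

module _ {xs : List ℕ} where

  relabel≤length : ∀ x → relabel xs x ≤ length xs
  relabel≤length zero    = ≤-refl
  relabel≤length (suc x) = length-filter (inRange? (suc x)) xs

  relabel≤ : Unique xs → ∀ x → relabel xs (suc x) ≤ suc x
  relabel≤ u x = begin
    length (positivesUpTo (suc x) xs) ≤⟨ Unique∧⊆⇒length≤ (Unique.filter⁺ (inRange? (suc x)) u) positives⊆ ⟩
    length (map suc (upTo (suc x)))   ≡⟨ length-map suc (upTo (suc x)) ⟩
    length (upTo (suc x))             ≡⟨ length-upTo (suc x) ⟩
    suc x                             ∎
    where
    open ≤-Reasoning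
    positives⊆ : positivesUpTo (suc x) xs ⊆ map suc (upTo (suc x))
    positives⊆ y∈ with ∈-filter⁻ (inRange? (suc x)) {xs = xs} y∈
    ... | _ , s≤s _ , y≤sx = ∈-map⁺ suc (∈-upTo⁺ y≤sx)

  relabel-positive : ∀ {y} → y ∈ xs → 0 < relabel xs y
  relabel-positive {zero}  0∈xs  = ∈-length 0∈xs
  relabel-positive {suc y} sy∈xs = ∈-length (∈-filter⁺ (inRange? (suc y)) sy∈xs (s≤s z≤n , ≤-refl))

  relabel<length : 0 ∈ xs → ∀ y → relabel xs (suc y) < length xs
  relabel<length 0∈xs y = filter-notAll (inRange? (suc y)) xs (Any.map (λ { refl (() , _) }) 0∈xs)

  relabel-strict : Unique xs → ∀ {x y} → suc y ∈ xs → x < y → relabel xs (suc x) < relabel xs (suc y)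
  relabel-strict u {x} {y} sy∈xs x<y =
    Unique∧⊆⇒length≤ (All.tabulate sy∉ ∷ Unique.filter⁺ (inRange? (suc x)) u) extended⊆
    where
    sy∉ : ∀ {z} → z ∈ positivesUpTo (suc x) xs → suc y ≢ z
    sy∉ z∈ refl = <⇒≱ (s≤s x<y) (proj₂ (proj₂ (∈-filter⁻ (inRange? (suc x)) {xs = xs} z∈)))
    extended⊆ : suc y ∷ positivesUpTo (suc x) xs ⊆ positivesUpTo (suc y) xs
    extended⊆ (here refl) = ∈-filter⁺ (inRange? (suc y)) sy∈xs (s≤s z≤n , ≤-refl)
    extended⊆ (there z∈) with ∈-filter⁻ (inRange? (suc x)) {xs = xs} z∈
    ... | z∈xs , 0<z , z≤sx = ∈-filter⁺ (inRange? (suc y)) z∈xs (0<z , ≤-trans z≤sx (s≤s (<⇒≤ x<y)))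

  relabel-injective : Unique xs → ∀ {x y} → x ∈ xs → y ∈ xs → relabel xs x ≡ relabel xs y → x ≡ y
  relabel-injective u {zero}  {zero}  _ _ _ = refl
  relabel-injective u {zero}  {suc y} 0∈xs _ eq = contradiction (sym eq) (<⇒≢ (relabel<length 0∈xs y))
  relabel-injective u {suc x} {zero}  _ 0∈xs eq = contradiction eq (<⇒≢ (relabel<length 0∈xs x))
  relabel-injective u {suc x} {suc y} sx∈xs sy∈xs eq with <-cmp x y
  ... | tri< x<y _ _ = contradiction eq (<⇒≢ (relabel-strict u sy∈xs x<y))
  ... | tri≈ _ x≡y _ = cong suc x≡y
  ... | tri> _ _ y<x = contradiction (sym eq) (<⇒≢ (relabel-strict u sx∈xs y<x))

contribution : ∀ {N} → (Fin N → ℕ) → (Fin N → Bool) → Fin N → ℕ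
contribution c D u = if D u then c u else 0

module Hairy {n : ℕ} (G : Graph n) (l : ℕ) where

  H : Graph (n + n * l)
  H = hairy G l

  ι : Fin n → Fin (n + n * l)
  ι v = v ↑ˡ (n * l)

  leaf : Fin n → Fin l → Fin (n + n * l)
  leaf v i = n ↑ʳ combine v i

  data HairyVertex : Fin (n + n * l) → Set where
    vertex  : ∀ v → HairyVertex (ι v)
    pendant : ∀ v i → HairyVertex (leaf v i)

  view : ∀ u → HairyVertex u
  view u with splitAt n u in eq
  ... | inj₁ v = subst HairyVertex (Fin.splitAt⁻¹-↑ˡ eq) (vertex v)
  ... | inj₂ j = subst HairyVertex (trans (cong (n ↑ʳ_) (Fin.combine-remQuot {n} l j)) (Fin.splitAt⁻¹-↑ʳ eq))
                   (uncurry pendant (remQuot {n} l j))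

  splitAt-ι : ∀ v → splitAt n (ι v) ≡ inj₁ v
  splitAt-ι v = Fin.splitAt-↑ˡ n v (n * l)

  splitAt-leaf : ∀ v i → splitAt n (leaf v i) ≡ inj₂ (combine v i)
  splitAt-leaf v i = Fin.splitAt-↑ʳ n (n * l) (combine v i)

  owner-leaf : ∀ v i → owner {n} l (combine v i) ≡ v
  owner-leaf v i = cong proj₁ (Fin.remQuot-combine v i)

  adj-ι-ι : ∀ u v → adj H (ι u) (ι v) ≡ adj G u v
  adj-ι-ι u v rewrite splitAt-ι u | splitAt-ι v = refl

  adj-leaf-ι : ∀ v i u → adj H (leaf v i) (ι u) ≡ does (u ≟ v)
  adj-leaf-ι v i u rewrite splitAt-ι u | splitAt-leaf v i | owner-leaf v i = refl

  adj-leaf-leaf : ∀ v i u j → adj H (leaf v i) (leaf u j) ≡ false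
  adj-leaf-leaf v i u j rewrite splitAt-leaf v i | splitAt-leaf u j = refl

  restrict-isColoring : ∀ {c} → IsColoring H c → IsColoring G (c ∘ ι)
  restrict-isColoring coloring u v uv = coloring (ι u) (ι v) (trans (adj-ι-ι u v) uv)

  leaf-adjacent-root : ∀ v i → Adjacent H (leaf v i) (ι v)
  leaf-adjacent-root v i = trans (adj-leaf-ι v i v) (dec-true (v ≟ v) refl)

  leaf-neighbour : ∀ v i {u} → Adjacent H (leaf v i) u → u ≡ ι v
  leaf-neighbour v i {u} adjacent with view u
  ... | vertex w with w ≟ v | adj-leaf-ι v i w
  ...   | yes refl | _  = refl
  ...   | no _     | eq = contradiction (trans (sym eq) adjacent) λ ()
  leaf-neighbour v i adjacent | pendant w j = contradiction (trans (sym (adj-leaf-leaf v i w j)) adjacent) λ ()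

  leaf-dominated : ∀ {c D} → IsUpColorDominating H c D → ∀ v i →
                   D (leaf v i) ≡ false → D (ι v) ≡ true × c (leaf v i) < c (ι v)
  leaf-dominated (dominated , _) v i leaf∉D with dominated (leaf v i) leaf∉D
  ... | d , d∈D , adjacent , c<c with leaf-neighbour v i adjacent
  ...   | refl = d∈D , c<c

  starWeight : (Fin (n + n * l) → ℕ) → (Fin (n + n * l) → Bool) → Fin n → ℕ
  starWeight c D v = contribution c D (ι v) + ∑[ i < l ] contribution c D (leaf v i)

  weight≡∑starWeight : ∀ c D → weight c D ≡ sum (starWeight c D)
  weight≡∑starWeight c D = begin
    weight c D                                        ≡⟨ sumˡ-allFin _ (contribution c D) ⟩
    sum (contribution c D)                            ≡⟨ sum-↑ n (contribution c D) ⟩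
    sum (contribution c D ∘ ι) + ∑[ j < n * l ] contribution c D (n ↑ʳ j)
      ≡⟨ cong (sum (contribution c D ∘ ι) +_) (sum-combine n (contribution c D ∘ (n ↑ʳ_))) ⟩
    sum (contribution c D ∘ ι) + ∑[ v < n ] ∑[ i < l ] contribution c D (leaf v i)
      ≡⟨ ∑-distrib-+ (contribution c D ∘ ι) _ ⟨
    sum (starWeight c D)                              ∎
    where open ≡-Reasoning

  lift : (Fin n → ℕ) → Fin (n + n * l) → ℕ
  lift g = [ g , const 0 ]′ ∘ splitAt n

  roots : Fin (n + n * l) → Bool
  roots = [ const true , const false ]′ ∘ splitAt n

  lift-ι : ∀ g v → lift g (ι v) ≡ g v
  lift-ι g v rewrite splitAt-ι v = refl

  lift-leaf : ∀ g v i → lift g (leaf v i) ≡ 0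
  lift-leaf g v i rewrite splitAt-leaf v i = refl

  roots-ι : ∀ v → roots (ι v) ≡ true
  roots-ι v rewrite splitAt-ι v = refl

  roots-leaf : ∀ v i → roots (leaf v i) ≡ false
  roots-leaf v i rewrite splitAt-leaf v i = refl

  module _ {g : Fin n → ℕ} (positive : ∀ v → 0 < g v) where

    lift-ι≢lift-leaf : ∀ a b j → lift g (ι a) ≢ lift g (leaf b j)
    lift-ι≢lift-leaf a b j rewrite lift-ι g a | lift-leaf g b j = >⇒≢ (positive a)

    lift-isColoring : IsColoring G g → IsColoring H (lift g)
    lift-isColoring proper u w adjacent with view u | view w
    ... | vertex a    | vertex b    rewrite lift-ι g a | lift-ι g b =
      proper a b (trans (sym (adj-ι-ι a b)) adjacent)
    ... | vertex a    | pendant b j = lift-ι≢lift-leaf a b j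
    ... | pendant a i | vertex b    = lift-ι≢lift-leaf b a i ∘ sym
    ... | pendant a i | pendant b j = contradiction (trans (sym (adj-leaf-leaf a i b j)) adjacent) λ ()

    roots-isUpColorDominating : IsUpColorDominating H (lift g) roots
    roots-isUpColorDominating = dominated , nonzero
      where
      dominated : ∀ u → roots u ≡ false → ∃ λ d → roots d ≡ true × Adjacent H u d × lift g u < lift g d
      dominated u u∉roots with view u
      ... | vertex v    = contradiction (trans (sym (roots-ι v)) u∉roots) λ ()
      ... | pendant v i = ι v , roots-ι v , leaf-adjacent-root v i ,
        subst₂ _<_ (sym (lift-leaf g v i)) (sym (lift-ι g v)) (positive v)
      nonzero : ∀ u → roots u ≡ true → lift g u ≢ 0
      nonzero u u∈roots with view u
      ... | vertex v    rewrite lift-ι g v = >⇒≢ (positive v)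
      ... | pendant v i = contradiction (trans (sym (roots-leaf v i)) u∈roots) λ ()

    weight-roots : weight (lift g) roots ≡ sum g
    weight-roots = trans (weight≡∑starWeight (lift g) roots) (sum-cong-≗ star≡g)
      where
      star≡g : ∀ v → starWeight (lift g) roots v ≡ g v
      star≡g v rewrite roots-ι v | lift-ι g v = begin
        g v + ∑[ i < l ] contribution (lift g) roots (leaf v i)
          ≡⟨ cong (g v +_) (sum-cong-≗ λ i → cong (if_then lift g (leaf v i) else 0) (roots-leaf v i)) ⟩
        g v + ∑[ i < l ] 0    ≡⟨ cong (g v +_) (sum-replicate-zero l) ⟩
        g v + 0               ≡⟨ +-identityʳ (g v) ⟩
        g v                   ∎
        where open ≡-Reasoning

    module _ (i₀ : Fin l) where

      sum≤weight : ∀ {D} → IsUpColorDominating H (lift g) D → sum g ≤ weight (lift g) D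
      sum≤weight {D} dom = begin
        sum g                          ≤⟨ sum-mono-≤ g≤star ⟩
        sum (starWeight (lift g) D)    ≡⟨ weight≡∑starWeight (lift g) D ⟨
        weight (lift g) D              ∎
        where
        open ≤-Reasoning
        root∈D : ∀ v → D (ι v) ≡ true
        root∈D v with D (leaf v i₀) in leaf∈D
        ... | true  = contradiction (lift-leaf g v i₀) (proj₂ dom (leaf v i₀) leaf∈D)
        ... | false = proj₁ (leaf-dominated dom v i₀ leaf∈D)
        g≤star : ∀ v → g v ≤ starWeight (lift g) D v
        g≤star v rewrite root∈D v | lift-ι g v = m≤m+n (g v) _

      lift-isOmegaUC : IsOmegaUC H (lift g) (sum g)
      lift-isOmegaUC = (roots , roots-isUpColorDominating , weight-roots) , λ _ → sum≤weight

      bigOmega≤sum : IsColoring G g → ∀ {w} → IsBigOmegaUC H w → w ≤ sum g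
      bigOmega≤sum proper (_ , minimal) = minimal (lift g) (sum g) (lift-isColoring proper) lift-isOmegaUC

module TooFewColours {n : ℕ} (G : Graph n) (k : ℕ) (χ : IsChromaticNumber G k)
  {c} (coloring : IsColoring (hairy G (suc k)) c) {D} (dom : IsUpColorDominating (hairy G (suc k)) c D)
  {w} (weight≡w : weight c D ≡ w) (optimal : IsBigOmegaUC (hairy G (suc k)) w)
  (few : numColors c ≤ k) where

  open Hairy G (suc k)

  L : List ℕ
  L = deduplicate _≟ℕ_ (map c (allFin (n + n * suc k)))

  c∈L : ∀ u → c u ∈ L
  c∈L u = ∈-deduplicate⁺ _≟ℕ_ (∈-map⁺ c (∈-allFin u))

  L-unique : Unique L
  L-unique = deduplicate-! _

  every-colour-on-G : ∀ {y} → y ∈ L → ∃ λ v → c (ι v) ≡ y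
  every-colour-on-G {y} y∈L with Fin.any? (λ v → c (ι v) ≟ℕ y)
  ... | yes found  = found
  ... | no missing = contradiction
    (χ≤length G χ (c ∘ ι) (restrict-isColoring coloring) avoids-y)
    (<⇒≱ (<-≤-trans fewer few))
    where
    ≢y? : ∀ z → Dec (z ≢ y)
    ≢y? = ¬? ∘ (_≟ℕ y)
    avoids-y : ∀ v → c (ι v) ∈ filter ≢y? L
    avoids-y v = ∈-filter⁺ ≢y? (c∈L (ι v)) (λ eq → missing (v , eq))
    fewer : length (filter ≢y? L) < length L
    fewer = filter-notAll ≢y? L (Any.map (λ y≡z z≢y → z≢y (sym y≡z)) y∈L)

  g : Fin n → ℕ
  g = relabel L ∘ c ∘ ι

  g-positive : ∀ v → 0 < g v
  g-positive v = relabel-positive (c∈L (ι v))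

  g-isColoring : IsColoring G g
  g-isColoring u v uv = restrict-isColoring coloring u v uv ∘
    relabel-injective L-unique (c∈L (ι u)) (c∈L (ι v))

  star : Fin n → ℕ
  star = starWeight c D

  contribution-positive : ∀ {u} → D u ≡ true → 0 < contribution c D u
  contribution-positive {u} u∈D rewrite u∈D = n≢0⇒n>0 (proj₂ dom u u∈D)

  star-root∉D : ∀ {v} → D (ι v) ≢ true → suc k ≤ star v
  star-root∉D {v} root∉D = ≤-trans (n≤sum leaf-positive) (m≤n+m _ (contribution c D (ι v)))
    where
    leaf-positive : ∀ i → 0 < contribution c D (leaf v i)
    leaf-positive i with D (leaf v i) in leaf∈D
    ... | true  = n≢0⇒n>0 (proj₂ dom (leaf v i) leaf∈D)
    ... | false = contradiction (proj₁ (leaf-dominated dom v i leaf∈D)) root∉D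

  star-root∈D : ∀ {v} → D (ι v) ≡ true → c (ι v) ≤ star v
  star-root∈D root∈D rewrite root∈D = m≤m+n _ _

  star-leaf∈D : ∀ {v i} → D (ι v) ≡ true → D (leaf v i) ≡ true → c (ι v) < star v
  star-leaf∈D {v} {i} root∈D leaf∈D rewrite root∈D =
    m<m+n (c (ι v)) (<-≤-trans (contribution-positive leaf∈D) (≤sum (λ i → contribution c D (leaf v i)) i))

  g≤k : ∀ v → g v ≤ k
  g≤k v = ≤-trans (relabel≤length (c (ι v))) few

  g≤colour : ∀ {v} → D (ι v) ≡ true → g v ≤ c (ι v)
  g≤colour {v} root∈D with c (ι v) | proj₂ dom (ι v) root∈D
  ... | zero  | c≢0 = contradiction refl c≢0
  ... | suc x | _   = relabel≤ L-unique x

  g≤star : ∀ v → g v ≤ star v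
  g≤star v with D (ι v) Bool.≟ true
  ... | yes root∈D = ≤-trans (g≤colour root∈D) (star-root∈D root∈D)
  ... | no  root∉D = ≤-trans (m≤n⇒m≤1+n (g≤k v)) (star-root∉D root∉D)

  g≡star : ∀ v → g v ≡ star v
  g≡star = sum-squeeze g≤star (begin
    sum star     ≡⟨ weight≡∑starWeight c D ⟨
    weight c D   ≡⟨ weight≡w ⟩
    w            ≤⟨ bigOmega≤sum g-positive zero g-isColoring optimal ⟩
    sum g        ∎)
    where open ≤-Reasoning

  leaf-below-root : ∀ v → c (leaf v zero) < c (ι v)
  leaf-below-root v with D (leaf v zero) in leaf∈D | D (ι v) Bool.≟ true
  ... | false | _          = proj₂ (leaf-dominated dom v zero leaf∈D)
  ... | true  | no root∉D  = contradiction (g≡star v) (<⇒≢ (<-≤-trans (s≤s (g≤k v)) (star-root∉D root∉D)))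
  ... | true  | yes root∈D = contradiction (g≡star v) (<⇒≢ (≤-<-trans (g≤colour root∈D) (star-leaf∈D root∈D leaf∈D)))

  descent : ∀ v → ∃ λ u → c (ι u) < c (ι v)
  descent v with every-colour-on-G (c∈L (leaf v zero))
  ... | u , same = u , subst (_< c (ι v)) (sym same) (leaf-below-root v)

  no-vertex : ¬ Fin n
  no-vertex = descent-impossible (c ∘ ι) descent

proposition6 : ∀ {n} (G : Graph n) → 1 ≤ n → (k : ℕ) → IsChromaticNumber G k →
    (c : Fin (n + n * suc k) → ℕ) → IsOmegaDominationColoring (hairy G (suc k)) c →
    suc k ≤ numColors c
proposition6 G 1≤n k χ c (coloring , w , ((D , dom , weight≡w) , _) , optimal) =
  ≮⇒≥ λ few → TooFewColours.no-vertex G k χ coloring dom weight≡w optimal (s≤s⁻¹ few) (fromℕ< 1≤n)
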